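{- The $\sim$-equivalence class of any upper prime consists entirely of upper primes of the same length, and the $\sim$-equivalence class of any lower prime consists entirely of lower primes of the same length.
   Context: Let $\mathcal{A}$ be the free associative $\mathbb{C}$-algebra on two generators $L$ and $R$ (letters). A word is a finite product of letters (possibly empty). A word is balanced if $L$ and $R$ occur in it equally many times. Let $S=\{FG-GF\colon F,G \text{ nonempty balanced words}\}$, let $\mathcal{J}$ be the two-sided ideal generated by $S$, and write $X\sim Y$ if $X-Y\in\mathcal{J}$. A word is prime if it is nonempty, balanced, and not a product of two nonempty balanced words. For a word $W=a_1\cdots a_n$, $e_k(W)=\sum_{i=1}^k\overline{a_i}$ with $\overline{R}=1$, $\overline{L}=-1$. A prime $P$ of length $l(P)$ is an upper prime if $e_k(P)>0$ for $1\le k\le l(P)-1$, and a lower prime if $e_k(P)<0$ for $1\le k\le l(P)-1$. -}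

module Defs where

open import Level using (Level; _⊔_)
open import Data.Nat using (ℕ; zero; suc; _≤_; _∸_)
open import Data.Integer using (ℤ; +_; -[1+_]; 0ℤ) renaming (_+_ to _+ℤ_; _<_ to _<ℤ_; _>_ to _>ℤ_)
open import Data.List using (List; []; _∷_; _++_; length; map; concatMap; take)
open import Data.Product using (Σ; _×_; _,_; ∃; ∃-syntax)
open import Relation.Nullary using (¬_; Dec; yes; no)
open import Relation.Binary.PropositionalEquality using (_≡_; refl; _≢_)
open import Algebra.Bundles using (CommutativeRing)

data Letter : Set where
  L R : Letter

Word : Set
Word = List Letter

_≟L_ : (a b : Letter) → Dec (a ≡ b)
L ≟L L = yes refl
L ≟L R = no λ ()
R ≟L L = no λ ()
R ≟L R = yes refl

_≟W_ : (u v : Word) → Dec (u ≡ v)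
[] ≟W [] = yes refl
[] ≟W (_ ∷ _) = no λ ()
(_ ∷ _) ≟W [] = no λ ()
(a ∷ u) ≟W (b ∷ v) with a ≟L b | u ≟W v
... | yes refl | yes refl = yes refl
... | no a≢b   | _        = no λ { refl → a≢b refl }
... | yes _    | no u≢v   = no λ { refl → u≢v refl }

countL : Word → ℕ
countL [] = 0
countL (L ∷ w) = suc (countL w)
countL (R ∷ w) = countL w

countR : Word → ℕ
countR [] = 0
countR (L ∷ w) = countR w
countR (R ∷ w) = suc (countR w)

Balanced : Word → Set
Balanced w = countL w ≡ countR w

NonEmpty : Word → Set
NonEmpty w = w ≢ []

Prime : Word → Set
Prime w = NonEmpty w × Balanced w ×
  (¬ (Σ Word λ u → Σ Word λ v →
        NonEmpty u × Balanced u × NonEmpty v × Balanced v × (w ≡ u ++ v)))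

val : Letter → ℤ
val L = -[1+ 0 ]
val R = + 1

sumVal : Word → ℤ
sumVal [] = 0ℤ
sumVal (a ∷ w) = val a +ℤ sumVal w

e : ℕ → Word → ℤ
e k w = sumVal (take k w)

UpperPrime : Word → Set
UpperPrime P = Prime P × (∀ k → 1 ≤ k → k ≤ length P ∸ 1 → e k P >ℤ 0ℤ)

LowerPrime : Word → Set
LowerPrime P = Prime P × (∀ k → 1 ≤ k → k ≤ length P ∸ 1 → e k P <ℤ 0ℤ)

IsFieldCR : ∀ {c ℓ} → CommutativeRing c ℓ → Set (c ⊔ ℓ)
IsFieldCR K = (¬ (1# ≈ 0#)) × (∀ x → ¬ (x ≈ 0#) → ∃[ y ] (x * y ≈ 1#))
  where open CommutativeRing K

-- The free associative algebra K⟨L,R⟩: elements are represented by finite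
-- formal linear combinations (lists of coefficient/word pairs); two such
-- lists denote the same element iff all their word-coefficients agree.
module FreeAlgebra {c ℓ} (K : CommutativeRing c ℓ) where
  open CommutativeRing K

  Lin : Set c
  Lin = List (Carrier × Word)

  coeff : Lin → Word → Carrier
  coeff [] w = 0#
  coeff ((a , u) ∷ xs) w with u ≟W w
  ... | yes _ = a + coeff xs w
  ... | no _  = coeff xs w

  _≋_ : Lin → Lin → Set ℓ
  X ≋ Y = ∀ w → coeff X w ≈ coeff Y w

  word : Word → Lin
  word w = (1# , w) ∷ []

  scale : Carrier → Lin → Lin
  scale a = map λ { (b , u) → (a * b , u) }

  _⊕_ : Lin → Lin → Lin
  X ⊕ Y = X ++ Y

  _⊖_ : Lin → Lin → Lin
  X ⊖ Y = X ++ scale (- 1#) Y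

  record Summand : Set c where
    constructor summand
    field
      coef : Carrier
      A F G B : Word
      F-ne : NonEmpty F
      F-bal : Balanced F
      G-ne : NonEmpty G
      G-bal : Balanced G

  summandLin : Summand → Lin
  summandLin s = scale coef ((1# , A ++ F ++ G ++ B) ∷ (- 1# , A ++ G ++ F ++ B) ∷ [])
    where open Summand s

  -- membership in the two-sided ideal J generated by S = {FG - GF}:
  -- X is a finite sum of elements c · A (FG - GF) B (A, B words, c ∈ K);
  -- this is exactly the K-span of {a s b : a, b ∈ K⟨L,R⟩, s ∈ S}.
  InJ : Lin → Set (c ⊔ ℓ)
  InJ X = Σ (List Summand) λ ss → X ≋ concatMap summandLin ss

  _∼_ : Lin → Lin → Set (c ⊔ ℓ)
  X ∼ Y = InJ (X ⊖ Y)

-- Interchanging two adjacent balanced factors, A F H B ↦ A H F B, changes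
-- neither the length, nor the letter counts, nor, for any set of forbidden
-- heights, the number of nonempty prefixes ending at a forbidden height e_k:
-- a balanced factor ends at the height it starts from.  Forbid the heights
-- ≤ 0 (for upper primes) or ≥ 0 (for lower primes).  A nonempty balanced word
-- ends at height 0, so the upper (lower) primes of length n are exactly the
-- balanced words of length n with a single forbidden prefix.  This finite set
-- G is therefore closed under the interchanges, and the linear functional
-- summing the coefficients of the words of G kills every generator
-- A (FH - HF) B of J.  It takes the value 1 on P - W when P ∈ G and W ∉ G, so
-- P ∼ W forces W ∈ G, because 1 ≠ 0.

module Submission where

open import Defs
open import Function using (_∘_)
open import Data.Bool using (Bool; true; false; T)
open import Data.Nat using (ℕ; zero; suc; _≤_; _∸_; z≤n; s≤s)
import Data.Nat.Properties as ℕ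
open import Data.Integer using (ℤ; 0ℤ; -[1+_]; _<?_) renaming (_+_ to _+ℤ_)
import Data.Integer.Properties as ℤ
open import Data.List using (List; []; _∷_; _++_; length; take; map; filter; concatMap)
open import Data.List.Properties using (∷-injectiveʳ; length-++; length-++-sucʳ; length-++-≤ˡ)
open import Data.List.Membership.Propositional using (_∈_; _∉_)
open import Data.List.Membership.Propositional.Properties using (∈-map⁺; ∈-map⁻; ∈-++⁺ˡ; ∈-++⁺ʳ; ∈-filter⁺; ∈-filter⁻)
open import Data.List.Relation.Unary.Any using (here; there)
open import Data.List.Relation.Unary.All using ([])
open import Data.List.Relation.Unary.AllPairs using ([]; _∷_)
open import Data.List.Relation.Unary.Unique.Propositional using (Unique)
import Data.List.Relation.Unary.Unique.Propositional.Properties as Unique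
open import Data.Product using (Σ; _×_; _,_; proj₁; proj₂)
open import Relation.Nullary using (¬_; Dec; yes; no; contradiction)
open import Relation.Nullary.Decidable using (isYes; toWitness; fromWitness; T?; _×-dec_)
open import Relation.Unary using (Decidable)
import Relation.Binary.PropositionalEquality as ≡
open import Algebra.Bundles using (CommutativeRing)
import Algebra.Properties.CommutativeSemigroup as CommutativeSemigroupProperties

SwapClosed : (Word → Set) → Set
SwapClosed G = ∀ A F H B → Balanced F → Balanced H → G (A ++ F ++ H ++ B) → G (A ++ H ++ F ++ B)

record Listing (G : Word → Set) : Set where
  field
    elements : List Word
    unique   : Unique elements
    sound    : ∀ {u} → u ∈ elements → G u
    complete : ∀ {u} → G u → u ∈ elements

module Weight {c ℓ} (K : CommutativeRing c ℓ) {G : Word → Set} (G? : Decidable G) where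
  open CommutativeRing K
  open FreeAlgebra K
  open import Relation.Binary.Reasoning.Setoid setoid
  open CommutativeSemigroupProperties +-commutativeSemigroup using (interchange)

  restrict : ∀ {A : Set} → Dec A → Carrier → Carrier
  restrict (yes _) a = a
  restrict (no _)  a = 0#

  weight : Lin → Carrier
  weight []             = 0#
  weight ((a , u) ∷ X) = restrict (G? u) a + weight X

  weight-++ : ∀ X Y → weight (X ++ Y) ≈ weight X + weight Y
  weight-++ []            Y = sym (+-identityˡ _)
  weight-++ ((a , u) ∷ X) Y = trans (+-congˡ (weight-++ X Y)) (sym (+-assoc _ _ _))

  weight-summand : SwapClosed G → ∀ s → weight (summandLin s) ≈ 0#
  weight-summand closed (summand k A F H B _ bF _ bH)
    with G? (A ++ F ++ H ++ B) | G? (A ++ H ++ F ++ B)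
  ... | yes _ | yes _ = begin
    k * 1# + (k * - 1# + 0#)   ≈⟨ +-congˡ (+-identityʳ _) ⟩
    k * 1# + k * - 1#          ≈⟨ distribˡ k 1# (- 1#) ⟨
    k * (1# + - 1#)            ≈⟨ *-congˡ (-‿inverseʳ 1#) ⟩
    k * 0#                     ≈⟨ zeroʳ k ⟩
    0#                         ∎
  ... | no _  | no _  = trans (+-identityˡ _) (+-identityˡ _)
  ... | yes g | no ¬g = contradiction (closed A F H B bF bH g) ¬g
  ... | no ¬g | yes g = contradiction (closed A H F B bH bF g) ¬g

  weight-ideal : SwapClosed G → ∀ ss → weight (concatMap summandLin ss) ≈ 0#
  weight-ideal closed []       = refl
  weight-ideal closed (s ∷ ss) = begin
    weight (summandLin s ++ concatMap summandLin ss)            ≈⟨ weight-++ (summandLin s) (concatMap summandLin ss) ⟩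
    weight (summandLin s) + weight (concatMap summandLin ss)    ≈⟨ +-cong (weight-summand closed s) (weight-ideal closed ss) ⟩
    0# + 0#                                                    ≈⟨ +-identityˡ 0# ⟩
    0#                                                         ∎

  sumOver : List Word → (Word → Carrier) → Carrier
  sumOver []      f = 0#
  sumOver (d ∷ D) f = f d + sumOver D f

  sumOver-cong : ∀ D {f g} → (∀ w → f w ≈ g w) → sumOver D f ≈ sumOver D g
  sumOver-cong []      _  = refl
  sumOver-cong (d ∷ D) eq = +-cong (eq d) (sumOver-cong D eq)

  sumOver-+ : ∀ D f g → sumOver D (λ w → f w + g w) ≈ sumOver D f + sumOver D g
  sumOver-+ []      f g = sym (+-identityˡ 0#)
  sumOver-+ (d ∷ D) f g =
    trans (+-congˡ (sumOver-+ D f g)) (interchange (f d) (g d) (sumOver D f) (sumOver D g))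

  sumOver-0 : ∀ D → sumOver D (λ _ → 0#) ≈ 0#
  sumOver-0 []      = refl
  sumOver-0 (d ∷ D) = trans (+-identityˡ _) (sumOver-0 D)

  coeffAt : Word → Carrier → Word → Carrier
  coeffAt u a w with u ≟W w
  ... | yes _ = a
  ... | no _  = 0#

  coeff-∷ : ∀ a u X w → coeff ((a , u) ∷ X) w ≈ coeffAt u a w + coeff X w
  coeff-∷ a u X w with u ≟W w
  ... | yes _ = refl
  ... | no _  = sym (+-identityˡ _)

  sumOver-coeffAt-∉ : ∀ D u a → u ∉ D → sumOver D (coeffAt u a) ≈ 0#
  sumOver-coeffAt-∉ []      u a _   = refl
  sumOver-coeffAt-∉ (d ∷ D) u a u∉ with u ≟W d
  ... | yes u≡d = contradiction (here u≡d) u∉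
  ... | no _    = trans (+-identityˡ _) (sumOver-coeffAt-∉ D u a (u∉ ∘ there))

  sumOver-coeffAt-∈ : ∀ D u a → Unique D → u ∈ D → sumOver D (coeffAt u a) ≈ a
  sumOver-coeffAt-∈ (d ∷ D) u a unique (here ≡.refl) with u ≟W u
  ... | yes _ = trans (+-congˡ (sumOver-coeffAt-∉ D u a (Unique.Unique[x∷xs]⇒x∉xs unique))) (+-identityʳ a)
  ... | no u≢u = contradiction ≡.refl u≢u
  sumOver-coeffAt-∈ (d ∷ D) u a (d∉D ∷ unique) (there u∈) with u ≟W d
  ... | yes ≡.refl = contradiction u∈ (Unique.Unique[x∷xs]⇒x∉xs (d∉D ∷ unique))
  ... | no _     = trans (+-identityˡ _) (sumOver-coeffAt-∈ D u a unique u∈)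

  -- Only a finite duplicate-free listing of G lets the weight be read off
  -- the coefficients, which is what makes it respect ≋.
  module _ (ℒ : Listing G) where
    open Listing ℒ

    sumOver-coeffAt : ∀ u a → sumOver elements (coeffAt u a) ≈ restrict (G? u) a
    sumOver-coeffAt u a with G? u
    ... | yes g = sumOver-coeffAt-∈ elements u a unique (complete g)
    ... | no ¬g = sumOver-coeffAt-∉ elements u a (¬g ∘ sound)

    sumOver-coeff : ∀ X → sumOver elements (coeff X) ≈ weight X
    sumOver-coeff []            = sumOver-0 elements
    sumOver-coeff ((a , u) ∷ X) = begin
      sumOver elements (coeff ((a , u) ∷ X))                     ≈⟨ sumOver-cong elements (coeff-∷ a u X) ⟩
      sumOver elements (λ w → coeffAt u a w + coeff X w)        ≈⟨ sumOver-+ elements (coeffAt u a) (coeff X) ⟩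
      sumOver elements (coeffAt u a) + sumOver elements (coeff X) ≈⟨ +-cong (sumOver-coeffAt u a) (sumOver-coeff X) ⟩
      restrict (G? u) a + weight X                               ∎

    weight-cong : ∀ X Y → X ≋ Y → weight X ≈ weight Y
    weight-cong X Y X≋Y =
      trans (sym (sumOver-coeff X)) (trans (sumOver-cong elements X≋Y) (sumOver-coeff Y))

    ∼-preserves : ¬ (1# ≈ 0#) → SwapClosed G → ∀ P W → G P → word P ∼ word W → G W
    ∼-preserves 1≉0 closed P W gP (ss , P-W≋J) with G? W
    ... | yes gW = gW
    ... | no ¬gW = contradiction (begin
      1#                                  ≈⟨ weight-P-W ⟨
      weight (word P ⊖ word W)            ≈⟨ weight-cong (word P ⊖ word W) (concatMap summandLin ss) P-W≋J ⟩
      weight (concatMap summandLin ss)    ≈⟨ weight-ideal closed ss ⟩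
      0#                                  ∎) 1≉0
      where
      weight-P-W : weight (word P ⊖ word W) ≈ 1#
      weight-P-W with G? P | G? W
      ... | yes _ | no _  = trans (+-congˡ (+-identityˡ 0#)) (+-identityʳ 1#)
      ... | no ¬gP | _    = contradiction gP ¬gP
      ... | _ | yes gW    = contradiction gW ¬gW

open import Data.Nat using (_+_)
open import Data.Integer using (_⊖_)
open import Relation.Binary.PropositionalEquality using (_≡_; refl; sym; trans; cong; cong₂; subst; module ≡-Reasoning)

words : ℕ → List Word
words zero    = [] ∷ []
words (suc n) = map (L ∷_) (words n) ++ map (R ∷_) (words n)

words-unique : ∀ n → Unique (words n)
words-unique zero    = [] ∷ []
words-unique (suc n) =
  Unique.++⁺ (Unique.map⁺ ∷-injectiveʳ (words-unique n)) (Unique.map⁺ ∷-injectiveʳ (words-unique n)) disjoint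
  where
  disjoint : ∀ {w} → ¬ (w ∈ map (L ∷_) (words n) × w ∈ map (R ∷_) (words n))
  disjoint (p , q) with ∈-map⁻ (L ∷_) p | ∈-map⁻ (R ∷_) q
  ... | _ , _ , refl | _ , _ , ()

∈-words : ∀ w → w ∈ words (length w)
∈-words []      = here refl
∈-words (L ∷ w) = ∈-++⁺ˡ (∈-map⁺ (L ∷_) (∈-words w))
∈-words (R ∷ w) = ∈-++⁺ʳ (map (L ∷_) (words (length w))) (∈-map⁺ (R ∷_) (∈-words w))

listing : ∀ {G} → Decidable G → ∀ n → (∀ {w} → G w → length w ≡ n) → Listing G
listing {G} G? n length≡ = record
  { elements = filter G? (words n)
  ; unique   = Unique.filter⁺ G? (words-unique n)
  ; sound    = λ m → proj₂ (∈-filter⁻ G? {xs = words n} m)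
  ; complete = λ {u} g → ∈-filter⁺ G? (subst (λ k → u ∈ words k) (length≡ g) (∈-words u)) g
  }

sumVal≡countR⊖countL : ∀ w → sumVal w ≡ countR w ⊖ countL w
sumVal≡countR⊖countL []      = refl
sumVal≡countR⊖countL (L ∷ w) =
  trans (cong (-[1+ 0 ] +ℤ_) (sumVal≡countR⊖countL w)) (ℤ.distribʳ-⊖-+-neg 0 (countR w) (countL w))
sumVal≡countR⊖countL (R ∷ w) =
  trans (cong (val R +ℤ_) (sumVal≡countR⊖countL w)) (ℤ.distribʳ-⊖-+-pos 1 (countR w) (countL w))

sumVal-balanced : ∀ w → Balanced w → sumVal w ≡ 0ℤ
sumVal-balanced w b =
  trans (sumVal≡countR⊖countL w) (subst (λ n → countR w ⊖ n ≡ 0ℤ) (sym b) (ℤ.n⊖n≡0 (countR w)))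

countL-++ : ∀ x y → countL (x ++ y) ≡ countL x + countL y
countL-++ []      y = refl
countL-++ (L ∷ x) y = cong suc (countL-++ x y)
countL-++ (R ∷ x) y = countL-++ x y

countR-++ : ∀ x y → countR (x ++ y) ≡ countR x + countR y
countR-++ []      y = refl
countR-++ (L ∷ x) y = countR-++ x y
countR-++ (R ∷ x) y = cong suc (countR-++ x y)

take-length-++ : ∀ (u v : Word) → take (length u) (u ++ v) ≡ u
take-length-++ []      v = refl
take-length-++ (a ∷ u) v = cong (a ∷_) (take-length-++ u v)

SwapInvariant : (Word → ℕ) → Set
SwapInvariant f = ∀ A F H B → Balanced F → Balanced H → f (A ++ F ++ H ++ B) ≡ f (A ++ H ++ F ++ B)

exchange-balanced : (f : Word → ℕ) → (∀ x y → Balanced x → f (x ++ y) ≡ f x + f y) →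
  ∀ F H B → Balanced F → Balanced H → f (F ++ H ++ B) ≡ f (H ++ F ++ B)
exchange-balanced f f-++ F H B bF bH = begin
  f (F ++ H ++ B)     ≡⟨ f-++ F (H ++ B) bF ⟩
  f F + f (H ++ B)    ≡⟨ cong (f F +_) (f-++ H B bH) ⟩
  f F + (f H + f B)   ≡⟨ ℕ-exchange (f F) (f H) (f B) ⟩
  f H + (f F + f B)   ≡⟨ cong (f H +_) (f-++ F B bF) ⟨
  f H + f (F ++ B)    ≡⟨ f-++ H (F ++ B) bH ⟨
  f (H ++ F ++ B)     ∎
  where
  open ≡-Reasoning
  open CommutativeSemigroupProperties ℕ.+-commutativeSemigroup using () renaming (x∙yz≈y∙xz to ℕ-exchange)

additive⇒swapInvariant : (f : Word → ℕ) → (∀ x y → f (x ++ y) ≡ f x + f y) → SwapInvariant f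
additive⇒swapInvariant f f-++ A F H B bF bH = begin
  f (A ++ F ++ H ++ B)    ≡⟨ f-++ A (F ++ H ++ B) ⟩
  f A + f (F ++ H ++ B)   ≡⟨ cong (f A +_) (exchange-balanced f (λ x y _ → f-++ x y) F H B bF bH) ⟩
  f A + f (H ++ F ++ B)   ≡⟨ f-++ A (H ++ F ++ B) ⟨
  f (A ++ H ++ F ++ B)    ∎
  where open ≡-Reasoning

defect : Bool → ℕ
defect true  = 0
defect false = 1

defect-T : ∀ {b} → T b → defect b ≡ 0
defect-T {true} _ = refl

defect-¬T : ∀ {b} → ¬ T b → defect b ≡ 1
defect-¬T {true}  ¬t = contradiction _ ¬t
defect-¬T {false} _  = refl

-- The height reached so far is absorbed into the predicate rather than carried
-- as an accumulator, matching e (suc k) (a ∷ w) = val a + e k w on the nose.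
badPrefixes : (ℤ → Bool) → Word → ℕ
badPrefixes ok []      = 0
badPrefixes ok (a ∷ w) = defect (ok (val a)) + badPrefixes (ok ∘ (val a +ℤ_)) w

badPrefixes-cong : ∀ {ok ok′} → (∀ z → ok z ≡ ok′ z) → ∀ w → badPrefixes ok w ≡ badPrefixes ok′ w
badPrefixes-cong eq []      = refl
badPrefixes-cong eq (a ∷ w) = cong₂ _+_ (cong defect (eq (val a))) (badPrefixes-cong (eq ∘ (val a +ℤ_)) w)

badPrefixes-++ : ∀ ok x y → badPrefixes ok (x ++ y) ≡ badPrefixes ok x + badPrefixes (ok ∘ (sumVal x +ℤ_)) y
badPrefixes-++ ok []      y = badPrefixes-cong (λ z → cong ok (sym (ℤ.+-identityˡ z))) y
badPrefixes-++ ok (a ∷ x) y = begin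
  d + badPrefixes ok′ (x ++ y)                                          ≡⟨ cong (d +_) (badPrefixes-++ ok′ x y) ⟩
  d + (badPrefixes ok′ x + badPrefixes (ok′ ∘ (sumVal x +ℤ_)) y)        ≡⟨ ℕ.+-assoc d _ _ ⟨
  d + badPrefixes ok′ x + badPrefixes (ok′ ∘ (sumVal x +ℤ_)) y          ≡⟨ cong (d + badPrefixes ok′ x +_) (badPrefixes-cong shift y) ⟩
  d + badPrefixes ok′ x + badPrefixes (ok ∘ (sumVal (a ∷ x) +ℤ_)) y     ∎
  where
  open ≡-Reasoning
  d = defect (ok (val a))
  ok′ = ok ∘ (val a +ℤ_)
  shift : ∀ z → ok (val a +ℤ (sumVal x +ℤ z)) ≡ ok (sumVal (a ∷ x) +ℤ z)
  shift z = cong ok (sym (ℤ.+-assoc (val a) (sumVal x) z))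

badPrefixes-++-balanced : ∀ ok x y → Balanced x → badPrefixes ok (x ++ y) ≡ badPrefixes ok x + badPrefixes ok y
badPrefixes-++-balanced ok x y b =
  trans (badPrefixes-++ ok x y) (cong (badPrefixes ok x +_) (badPrefixes-cong height-unchanged y))
  where
  height-unchanged : ∀ z → ok (sumVal x +ℤ z) ≡ ok z
  height-unchanged z = cong ok (trans (cong (_+ℤ z) (sumVal-balanced x b)) (ℤ.+-identityˡ z))

badPrefixes-swapInvariant : ∀ ok → SwapInvariant (badPrefixes ok)
badPrefixes-swapInvariant ok A F H B bF bH = begin
  badPrefixes ok (A ++ F ++ H ++ B)                       ≡⟨ badPrefixes-++ ok A (F ++ H ++ B) ⟩
  badPrefixes ok A + badPrefixes ok′ (F ++ H ++ B)        ≡⟨ cong (badPrefixes ok A +_) exchange ⟩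
  badPrefixes ok A + badPrefixes ok′ (H ++ F ++ B)        ≡⟨ badPrefixes-++ ok A (H ++ F ++ B) ⟨
  badPrefixes ok (A ++ H ++ F ++ B)                       ∎
  where
  open ≡-Reasoning
  ok′ = ok ∘ (sumVal A +ℤ_)
  exchange = exchange-balanced (badPrefixes ok′) (badPrefixes-++-balanced ok′) F H B bF bH

ProperPrefixesOk : (ℤ → Bool) → Word → Set
ProperPrefixesOk ok w = ∀ k → 1 ≤ k → k ≤ length w ∸ 1 → T (ok (e k w))

ok-head : ∀ ok a b w → ProperPrefixesOk ok (a ∷ b ∷ w) → T (ok (val a))
ok-head ok a b w P = subst (T ∘ ok) (ℤ.+-identityʳ (val a)) (P 1 (s≤s z≤n) (s≤s z≤n))

badPrefixes-properPrefixesOk : ∀ ok a w → ProperPrefixesOk ok (a ∷ w) →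
  badPrefixes ok (a ∷ w) ≡ defect (ok (sumVal (a ∷ w)))
badPrefixes-properPrefixesOk ok a []      _ =
  trans (ℕ.+-identityʳ _) (cong (defect ∘ ok) (sym (ℤ.+-identityʳ (val a))))
badPrefixes-properPrefixesOk ok a (b ∷ w) P = begin
  defect (ok (val a)) + badPrefixes ok′ (b ∷ w)   ≡⟨ cong (_+ badPrefixes ok′ (b ∷ w)) (defect-T (ok-head ok a b w P)) ⟩
  badPrefixes ok′ (b ∷ w)                         ≡⟨ badPrefixes-properPrefixesOk ok′ b w P-tail ⟩
  defect (ok (sumVal (a ∷ b ∷ w)))                ∎
  where
  open ≡-Reasoning
  ok′ = ok ∘ (val a +ℤ_)
  P-tail : ProperPrefixesOk ok′ (b ∷ w)
  P-tail k 1≤k k≤ = P (suc k) (s≤s z≤n) (s≤s k≤)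

defect-total≤badPrefixes : ∀ ok a w → defect (ok (sumVal (a ∷ w))) ≤ badPrefixes ok (a ∷ w)
defect-total≤badPrefixes ok a []      rewrite ℤ.+-identityʳ (val a) | ℕ.+-identityʳ (defect (ok (val a))) = ℕ.≤-refl
defect-total≤badPrefixes ok a (b ∷ w) =
  ℕ.≤-trans (defect-total≤badPrefixes (ok ∘ (val a +ℤ_)) b w) (ℕ.m≤n+m _ (defect (ok (val a))))

defect-proper+total≤badPrefixes : ∀ ok a w k → 1 ≤ k → k ≤ length w →
  defect (ok (e k (a ∷ w))) + defect (ok (sumVal (a ∷ w))) ≤ badPrefixes ok (a ∷ w)
defect-proper+total≤badPrefixes ok a (b ∷ w) 1 _ _ rewrite ℤ.+-identityʳ (val a) =
  ℕ.+-monoʳ-≤ (defect (ok (val a))) (defect-total≤badPrefixes (ok ∘ (val a +ℤ_)) b w)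
defect-proper+total≤badPrefixes ok a (b ∷ w) (suc (suc k)) _ (s≤s k≤) =
  ℕ.≤-trans (defect-proper+total≤badPrefixes (ok ∘ (val a +ℤ_)) b w (suc k) (s≤s z≤n) k≤)
            (ℕ.m≤n+m _ (defect (ok (val a))))

properPrefixesOk⇒indecomposable : ∀ ok → ¬ T (ok 0ℤ) → ∀ w → ProperPrefixesOk ok w →
  ¬ (Σ Word λ u → Σ Word λ v → NonEmpty u × Balanced u × NonEmpty v × Balanced v × (w ≡ u ++ v))
properPrefixesOk⇒indecomposable ok ¬ok-0 w P ([] , _ , u≢[] , _) = u≢[] refl
properPrefixesOk⇒indecomposable ok ¬ok-0 w P (_ , [] , _ , _ , v≢[] , _) = v≢[] refl
properPrefixesOk⇒indecomposable ok ¬ok-0 w P (a ∷ u , b ∷ v , _ , bu , _ , _ , refl) =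
  ¬ok-0 (subst (T ∘ ok) height-0 (P (suc (length u)) (s≤s z≤n) u<length))
  where
  u<length : suc (length u) ≤ length (u ++ b ∷ v)
  u<length = subst (suc (length u) ≤_) (sym (length-++-sucʳ u b v)) (s≤s (length-++-≤ˡ u))
  height-0 : e (length (a ∷ u)) (a ∷ u ++ b ∷ v) ≡ 0ℤ
  height-0 = trans (cong sumVal (take-length-++ (a ∷ u) (b ∷ v))) (sumVal-balanced (a ∷ u) bu)

module HeightCondition (ok : ℤ → Bool) (¬ok-0 : ¬ T (ok 0ℤ)) where

  OkPrime : Word → Set
  OkPrime P = Prime P × ProperPrefixesOk ok P

  Good : ℕ → Word → Set
  Good n w = length w ≡ n × Balanced w × badPrefixes ok w ≡ 1

  good? : ∀ n → Decidable (Good n)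
  good? n w = length w ℕ.≟ n ×-dec countL w ℕ.≟ countR w ×-dec badPrefixes ok w ℕ.≟ 1

  good-swapClosed : ∀ n → SwapClosed (Good n)
  good-swapClosed n A F H B bF bH (len , bal , bad) =
    trans (sym (swap length (λ x y → length-++ x))) len ,
    trans (sym (swap countL countL-++)) (trans bal (swap countR countR-++)) ,
    trans (sym (badPrefixes-swapInvariant ok A F H B bF bH)) bad
    where
    swap : (f : Word → ℕ) → (∀ x y → f (x ++ y) ≡ f x + f y) → f (A ++ F ++ H ++ B) ≡ f (A ++ H ++ F ++ B)
    swap f f-++ = additive⇒swapInvariant f f-++ A F H B bF bH

  defect-balanced : ∀ w → Balanced w → defect (ok (sumVal w)) ≡ 1
  defect-balanced w b = trans (cong (defect ∘ ok) (sumVal-balanced w b)) (defect-¬T ¬ok-0)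

  okPrime⇒good : ∀ P → OkPrime P → Good (length P) P
  okPrime⇒good []      ((P≢[] , _) , _) = contradiction refl P≢[]
  okPrime⇒good (a ∷ w) ((_ , b , _) , P) =
    refl , b , trans (badPrefixes-properPrefixesOk ok a w P) (defect-balanced (a ∷ w) b)

  good⇒okPrime : ∀ n W → Good (suc n) W → OkPrime W
  good⇒okPrime n (a ∷ w) (_ , b , one) =
    ((λ ()) , b , properPrefixesOk⇒indecomposable ok ¬ok-0 (a ∷ w) P) , P
    where
    P : ProperPrefixesOk ok (a ∷ w)
    P k 1≤k k≤ with T? (ok (e k (a ∷ w)))
    ... | yes t = t
    ... | no ¬t = contradiction (begin
      2                                                        ≡⟨ cong₂ _+_ (defect-¬T ¬t) (defect-balanced (a ∷ w) b) ⟨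
      defect (ok (e k (a ∷ w))) + defect (ok (sumVal (a ∷ w)))  ≤⟨ defect-proper+total≤badPrefixes ok a w k 1≤k k≤ ⟩
      badPrefixes ok (a ∷ w)                                    ≡⟨ one ⟩
      1                                                        ∎) λ { (s≤s ()) }
      where open ℕ.≤-Reasoning

∼-preserves-heightPrime : ∀ {c ℓ} (K : CommutativeRing c ℓ) →
  ¬ (CommutativeRing._≈_ K (CommutativeRing.1# K) (CommutativeRing.0# K)) →
  ∀ {Allowed : ℤ → Set} → Decidable Allowed → ¬ Allowed 0ℤ →
  ∀ P W → Prime P × (∀ k → 1 ≤ k → k ≤ length P ∸ 1 → Allowed (e k P)) →
  FreeAlgebra._∼_ K (FreeAlgebra.word K P) (FreeAlgebra.word K W) →
  (Prime W × (∀ k → 1 ≤ k → k ≤ length W ∸ 1 → Allowed (e k W))) × length W ≡ length P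
∼-preserves-heightPrime K 1≉0 allowed? ¬allowed-0 []      W ((P≢[] , _) , _) _ = contradiction refl P≢[]
∼-preserves-heightPrime K 1≉0 allowed? ¬allowed-0 (a ∷ p) W (primeP , allowedP) P∼W =
  (proj₁ okW , λ k 1≤k k≤ → toWitness (proj₂ okW k 1≤k k≤)) , proj₁ goodW
  where
  open HeightCondition (isYes ∘ allowed?) (¬allowed-0 ∘ toWitness)
  n = length p
  goodW : Good (suc n) W
  goodW = Weight.∼-preserves K (good? (suc n)) (listing (good? (suc n)) (suc n) proj₁) 1≉0 (good-swapClosed (suc n))
    (a ∷ p) W (okPrime⇒good (a ∷ p) (primeP , λ k 1≤k k≤ → fromWitness (allowedP k 1≤k k≤))) P∼W
  okW : OkPrime W
  okW = good⇒okPrime n W goodW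

lemma5p6 : ∀ {c ℓ} (K : CommutativeRing c ℓ) → IsFieldCR K →
    (∀ (P W : Word) → UpperPrime P →
      FreeAlgebra._∼_ K (FreeAlgebra.word K P) (FreeAlgebra.word K W) →
      UpperPrime W × length W ≡ length P)
    ×
    (∀ (P W : Word) → LowerPrime P →
      FreeAlgebra._∼_ K (FreeAlgebra.word K P) (FreeAlgebra.word K W) →
      LowerPrime W × length W ≡ length P)
lemma5p6 K (1≉0 , _) =
  ∼-preserves-heightPrime K 1≉0 (0ℤ <?_) (ℤ.<-irrefl refl) ,
  ∼-preserves-heightPrime K 1≉0 (_<? 0ℤ) (ℤ.<-irrefl refl)
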